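{- The identity function $\operatorname{id}$ on $\mathbb{N}^\mathbb{N}$ is a strong minimal cover of $\operatorname{id}\restriction_{\mathrm{NR}}$ in the Weihrauch degrees, where $\mathrm{NR}:=\{q\in\mathbb{N}^\mathbb{N} : q \text{ is not computable}\}$.
   Context: A partial multi-valued function $f$ on Baire space assigns to each $x\in\operatorname{dom}(f)\subseteq\mathbb{N}^\mathbb{N}$ a nonempty set $f(x)\subseteq\mathbb{N}^\mathbb{N}$. $f\le_{\mathrm{W}} g$ (Weihrauch reducibility) means there are partial computable functionals $\Phi,\Psi$ such that for every $p\in\operatorname{dom}(f)$, $\Phi(p)\in\operatorname{dom}(g)$ and for every $q\in g(\Phi(p))$, $\Psi(p,q)\in f(p)$. $f$ is a strong minimal cover of $h$ if $h<_{\mathrm{W}} f$ and every $c$ with $c<_{\mathrm{W}} f$ satisfies $c\le_{\mathrm{W}} h$. For $X\subseteq\mathbb{N}^\mathbb{N}$, $\operatorname{id}\restriction_X$ is the identity on Baire space restricted to $X$. -}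

module Defs where

open import Data.Nat using (ℕ; zero; suc; _<_)
open import Data.Fin using (Fin)
open import Data.Vec using (Vec; []; _∷_; lookup)
open import Data.Product using (Σ; _×_; _,_)
open import Data.Unit using (⊤)
open import Relation.Nullary using (¬_)
open import Relation.Binary.PropositionalEquality using (_≡_)

Baire : Set
Baire = ℕ → ℕ

_≈B_ : Baire → Baire → Set
p ≈B q = ∀ n → p n ≡ q n

-- Partial recursive (μ-recursive) functions relative to k oracles.
-- PR k n : codes of n-ary partial functions computable from k oracles.

data PR (k : ℕ) : ℕ → Set where
  zer  : ∀ {n} → PR k n
  sucF : PR k 1
  proj : ∀ {n} → Fin n → PR k n
  orc  : Fin k → PR k 1
  comp : ∀ {m n} → PR k m → (Fin m → PR k n) → PR k n
  prec : ∀ {n} → PR k n → PR k (suc (suc n)) → PR k (suc n)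
  mu   : ∀ {n} → PR k (suc n) → PR k n

-- Big-step evaluation relative to oracles os : Eval os e xs y means e(xs) ↓ = y.
data Eval {k : ℕ} (os : Fin k → Baire) : ∀ {n} → PR k n → Vec ℕ n → ℕ → Set where
  e-zer  : ∀ {n} {xs : Vec ℕ n} → Eval os zer xs 0
  e-suc  : ∀ {x} → Eval os sucF (x ∷ []) (suc x)
  e-proj : ∀ {n} {xs : Vec ℕ n} (i : Fin n) → Eval os (proj i) xs (lookup xs i)
  e-orc  : ∀ {x} (i : Fin k) → Eval os (orc i) (x ∷ []) (os i x)
  e-comp : ∀ {m n} {f : PR k m} {g : Fin m → PR k n} {xs : Vec ℕ n} {y}
           (ys : Vec ℕ m) → (∀ i → Eval os (g i) xs (lookup ys i)) →
           Eval os f ys y → Eval os (comp f g) xs y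
  e-rec0 : ∀ {n} {g : PR k n} {h : PR k (suc (suc n))} {xs : Vec ℕ n} {y} →
           Eval os g xs y → Eval os (prec g h) (0 ∷ xs) y
  e-recS : ∀ {n} {g : PR k n} {h : PR k (suc (suc n))} {xs : Vec ℕ n} {x z y} →
           Eval os (prec g h) (x ∷ xs) z → Eval os h (x ∷ z ∷ xs) y →
           Eval os (prec g h) (suc x ∷ xs) y
  e-mu   : ∀ {n} {f : PR k (suc n)} {xs : Vec ℕ n} {y} →
           Eval os f (y ∷ xs) 0 →
           (∀ j → j < y → Σ ℕ (λ v → Eval os f (j ∷ xs) (suc v))) →
           Eval os (mu f) xs y

Computes : ∀ {k} → PR k 1 → (Fin k → Baire) → Baire → Set
Computes e os q = ∀ n → Eval os e (n ∷ []) (q n)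

one : Baire → Fin 1 → Baire
one p _ = p

two : Baire → Baire → Fin 2 → Baire
two p q Fin.zero = p
two p q (Fin.suc _) = q

noOracle : Fin 0 → Baire
noOracle ()

Computable : Baire → Set
Computable q = Σ (PR 0 1) (λ e → Computes e noOracle q)

record MVF : Set₁ where
  field
    dom      : Baire → Set
    val      : Baire → Baire → Set          -- val x y : y ∈ f(x)
    nonempty : ∀ x → dom x → Σ Baire (val x)
open MVF public

_≤W_ : MVF → MVF → Set
f ≤W g = Σ (PR 1 1) λ Φ → Σ (PR 2 1) λ Ψ →
  ∀ p → dom f p →
    Σ Baire λ r → Computes Φ (one p) r × dom g r ×
      (∀ q → val g r q →
         Σ Baire λ s → Computes Ψ (two p q) s × val f p s)

_<W_ : MVF → MVF → Set
f <W g = (f ≤W g) × ¬ (g ≤W f)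

StrongMinimalCover : MVF → MVF → Set₁
StrongMinimalCover f h = (h <W f) × (∀ (c : MVF) → c <W f → c ≤W h)

idOn : (Baire → Set) → MVF
idOn X = record
  { dom = X
  ; val = λ x y → y ≈B x
  ; nonempty = λ x _ → x , (λ n → Relation.Binary.PropositionalEquality.refl) }

idB : MVF
idB = idOn (λ _ → ⊤)

NR : Baire → Set
NR q = ¬ Computable q

-- A problem c with c <W id has no computable point in its domain: from such
-- a point p, the constant reduction sending every instance to p together
-- with the backward map "return the original instance" would give id ≤W c.
-- So every instance of c is already an instance of id↾NR, and the reduction
-- c ≤W id can be replayed against id↾NR, its backward functional recomputing
-- the forward image instead of reading the answer. Conversely id ≰W id↾NR,
-- since the forward functional maps the computable point 0^ω to a computable
-- point, which is not in NR.
{-# OPTIONS --safe #-}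
module Submission where

open import Defs
open import Data.Nat using (ℕ; suc)
open import Data.Fin using (Fin; zero; suc)
open import Data.Vec using ([]; _∷_)
open import Data.Product using (Σ; _×_; _,_; proj₁; proj₂)
open import Data.Unit using (tt)
open import Relation.Nullary using (¬_)
open import Relation.Binary.PropositionalEquality using (refl)

substitute : ∀ {k k' n} → (Fin k → PR k' 1) → PR k n → PR k' n
substitute σ zer        = zer
substitute σ sucF       = sucF
substitute σ (proj i)   = proj i
substitute σ (orc i)    = σ i
substitute σ (comp f g) = comp (substitute σ f) (λ i → substitute σ (g i))
substitute σ (prec g h) = prec (substitute σ g) (substitute σ h)
substitute σ (mu f)     = mu (substitute σ f)

module _ {k k'} {os : Fin k → Baire} {os' : Fin k' → Baire}
         (σ : Fin k → PR k' 1) (σ-computes : ∀ i → Computes (σ i) os' (os i)) where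

  substitute-sound : ∀ {n} {e : PR k n} {xs y} → Eval os e xs y → Eval os' (substitute σ e) xs y
  substitute-sound e-zer            = e-zer
  substitute-sound e-suc            = e-suc
  substitute-sound (e-proj i)       = e-proj i
  substitute-sound (e-orc {x} i)    = σ-computes i x
  substitute-sound (e-comp ys g f)  = e-comp ys (λ i → substitute-sound (g i)) (substitute-sound f)
  substitute-sound (e-rec0 g)       = e-rec0 (substitute-sound g)
  substitute-sound (e-recS r h)     = e-recS (substitute-sound r) (substitute-sound h)
  substitute-sound (e-mu f below)   = e-mu (substitute-sound f) λ j j<y → nonzero (below j j<y)
    where
    nonzero : ∀ {n} {e : PR k n} {xs} → Σ ℕ (λ v → Eval os e xs (suc v)) →
              Σ ℕ (λ v → Eval os' (substitute σ e) xs (suc v))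
    nonzero (v , ev) = v , substitute-sound ev

  substitute-computes : ∀ {e q} → Computes e os q → Computes (substitute σ e) os' q
  substitute-computes e-q n = substitute-sound (e-q n)

relativize : ∀ {k n} → PR 0 n → PR k n
relativize = substitute λ ()

relativize-computes : ∀ {k} {os : Fin k → Baire} {e q} →
                      Computes e noOracle q → Computes (relativize e) os q
relativize-computes = substitute-computes (λ ()) (λ ())

computable-from-computable-oracles : ∀ {k} {os : Fin k → Baire} {e q} →
  (∀ i → Computable (os i)) → Computes e os q → Computable q
computable-from-computable-oracles {e = e} os-computable e-q =
  substitute code e , substitute-computes code (λ i → proj₂ (os-computable i)) e-q
  where
  code : Fin _ → PR 0 1
  code i = proj₁ (os-computable i)

idOn-mono : ∀ {X Y : Baire → Set} → (∀ p → X p → Y p) → idOn X ≤W idOn Y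
idOn-mono X⊆Y = orc zero , orc (suc zero) , λ p Xp →
  p , (λ n → e-orc zero) , X⊆Y p Xp , λ q q≈p → q , (λ n → e-orc (suc zero)) , q≈p

idB≰W-noncomputable-domain : ∀ {g} → (∀ r → dom g r → ¬ Computable r) → ¬ (idB ≤W g)
idB≰W-noncomputable-domain dom-noncomputable (_ , _ , reduce)
  with reduce (λ _ → 0) tt
... | r , Φ-r , dom-r , _ =
  dom-noncomputable r dom-r (computable-from-computable-oracles (λ _ → zer , λ n → e-zer) Φ-r)

idB≤W-computable-in-domain : ∀ {c p} → Computable p → dom c p → idB ≤W c
idB≤W-computable-in-domain {p = p} (e , e-p) dom-p =
  relativize e , orc zero , λ x _ →
    p , relativize-computes e-p , dom-p , λ _ _ → x , (λ n → e-orc zero) , (λ n → refl)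

≤W-idB⇒≤W-idOn : ∀ {c X} → c ≤W idB → (∀ p → dom c p → X p) → c ≤W idOn X
≤W-idB⇒≤W-idOn {c} (Φ , Ψ , reduce) dom⊆X =
  orc zero , substitute σ Ψ , λ p dom-p →
    p , (λ n → e-orc zero) , dom⊆X p dom-p , λ q _ → replay p dom-p q
  where
  σ : Fin 2 → PR 2 1
  σ zero    = orc zero
  σ (suc _) = substitute (λ _ → orc zero) Φ

  replay : ∀ p → dom c p → ∀ q → Σ Baire λ s → Computes (substitute σ Ψ) (two p q) s × val c p s
  replay p dom-p q with reduce p dom-p
  ... | r , Φ-r , _ , backward with backward r (λ n → refl)
  ... | s , Ψ-s , s∈c = s , substitute-computes σ σ-computes Ψ-s , s∈c
    where
    σ-computes : ∀ i → Computes (σ i) (two p q) (two p r i)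
    σ-computes zero       = λ _ → e-orc zero
    σ-computes (suc zero) = substitute-computes (λ _ → orc zero) (λ _ n → e-orc zero) Φ-r

mainTheorem14 : StrongMinimalCover idB (idOn NR)
mainTheorem14 =
  (idOn-mono (λ _ _ → tt) , idB≰W-noncomputable-domain {idOn NR} (λ _ r∈NR → r∈NR)) ,
  λ c (c≤idB , idB≰c) →
    ≤W-idB⇒≤W-idOn {c} {NR} c≤idB (λ p dom-p p-computable →
      idB≰c (idB≤W-computable-in-domain {c} p-computable dom-p))
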